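{- For every integer $n\ge 3$ there exists a Heffter array $H(5,n)$. If moreover $n\equiv 0,3\pmod 4$, then the array can be taken to be an integer Heffter array.
   Context: A (tight) Heffter array $H(m,n)$ is an $m\times n$ array with every cell filled by an element of $\mathbb{Z}_{2mn+1}$ such that every row and every column sums to $0$ modulo $2mn+1$, and no element of any pair $\{x,-x\}$ appears twice (using representatives $-mn,\dots,mn$, entries are nonzero and each of $1,\dots,mn$ appears exactly once up to sign). An integer Heffter array $H(m,n)$ is an $m\times n$ array with entries from $\{ -mn,\dots,mn\}$ such that every row and column sums to $0$ over the integers and no element from any $\{x,-x\}$ appears twice, so the multiset of absolute values of entries is $\{1,\dots,mn\}$. -}

module Defs where

open import Data.Nat using (ℕ; suc; _≥_)
open import Data.Nat.Base as ℕ using ()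
open import Data.Integer using (ℤ; +_; ∣_∣; _+_; -_)
open import Data.Integer.Divisibility using (_∣_)
open import Data.Fin using (Fin; zero; suc)
open import Data.Product using (_×_; _,_; Σ)
open import Relation.Binary.PropositionalEquality using (_≡_)

-- An m × n array of integers (representatives of Z_{2mn+1} in -mn..mn).
Array : ℕ → ℕ → Set
Array m n = Fin m → Fin n → ℤ

sumℤ : ∀ {k} → (Fin k → ℤ) → ℤ
sumℤ {ℕ.zero} f = + 0
sumℤ {suc k} f = f zero + sumℤ (λ i → f (suc i))

rowSum : ∀ {m n} → Array m n → Fin m → ℤ
rowSum A i = sumℤ (λ j → A i j)

colSum : ∀ {m n} → Array m n → Fin n → ℤ
colSum A j = sumℤ (λ i → A i j)

-- Since there
-- are mn cells, this says the multiset of absolute values is {1,…,mn}.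
AbsCondition : ∀ {m n} → Array m n → Set
AbsCondition {m} {n} A =
  (∀ i j → 1 ℕ.≤ ∣ A i j ∣ × ∣ A i j ∣ ℕ.≤ m ℕ.* n) ×
  (∀ i j i′ j′ → ∣ A i j ∣ ≡ ∣ A i′ j′ ∣ → (i ≡ i′ × j ≡ j′))

IsHeffter : ∀ m n → Array m n → Set
IsHeffter m n A =
  AbsCondition A ×
  (∀ i → + (2 ℕ.* (m ℕ.* n) ℕ.+ 1) ∣ rowSum A i) ×
  (∀ j → + (2 ℕ.* (m ℕ.* n) ℕ.+ 1) ∣ colSum A j)

IsIntegerHeffter : ∀ m n → Array m n → Set
IsIntegerHeffter m n A =
  AbsCondition A ×
  (∀ i → rowSum A i ≡ + 0) ×
  (∀ j → colSum A j ≡ + 0)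

-- Write n = 4s + n₀ with n₀ ∈ {3, 4, 5, 6}. The array consists of s copies of a 5 × 4 block
-- followed by n₀ core columns, and the absolute values 1, …, 5n are cut into seven consecutive
-- intervals: four core intervals of fixed sizes and three bands of sizes 10s, 4s and 6s, from
-- which every block takes its 20 values according to its position. Each core entry is then
-- affine in s, and each block entry affine in the numbers q, t of blocks to its left and right.
-- So every line sum is affine in these parameters, and finitely many identities between
-- coefficients suffice: block lines sum to 0 identically, while a core line whose constant terms
-- sum to γ(2n₀ + 1) and whose s-coefficients sum to 40γ sums to γ(2n + 1), because
-- 2n + 1 = 2n₀ + 1 + 40s. These identities, and the fact that distinct cells receive distinct
-- values, are checked by evaluation for one design per n₀; for n₀ = 3, 4 all the quotients γ
-- vanish, which gives integer Heffter arrays.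
module Submission where

open import Defs
open import Data.Nat using (ℕ; _≥_; _%_)
open import Data.Product using (_×_; Σ)
open import Data.Sum using (_⊎_)
open import Relation.Binary.PropositionalEquality using (_≡_)

open import Data.Nat using (NonZero; zero; suc; _+_; _*_; _<_; _≤_; _<?_; z≤n; s≤s)
import Data.Nat.Properties as ℕₚ
open import Data.Nat.Properties using (allUpTo?)
open import Data.Nat.DivMod using (%-remove-+ˡ; m<n⇒m%n≡m; [m+kn]%n≡m%n)
open import Data.Nat.Divisibility using (m∣m*n)
open import Data.Nat.Tactic.RingSolver using (solve-∀)
open import Data.Integer as ℤ using (ℤ; +_; _◃_)
import Data.Integer.Properties as ℤₚ
import Data.Integer.Tactic.RingSolver as ℤ-Solver
open import Data.Integer.Divisibility using (_∣_; divides)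
open import Data.Sign using (Sign)
open import Data.Fin using (Fin; toℕ)
open import Data.Fin.Properties using (toℕ<n; toℕ-injective)
open import Data.List using (List; []; _∷_)
open import Data.Product using (_,_)
open import Data.Sum as Sum using (inj₁; inj₂)
open import Data.Empty using (⊥; ⊥-elim)
open import Function using (_∘_)
open import Relation.Binary.Definitions using (tri<; tri≈; tri>)
open import Relation.Binary.PropositionalEquality
  using (refl; sym; trans; cong; cong₂; subst; module ≡-Reasoning)
open import Relation.Nullary using (Dec; ¬_; yes; no)
open import Relation.Nullary.Decidable using (map′; _×-dec_; _→-dec_; from-yes)


∑ : ℕ → (ℕ → ℤ) → ℤ
∑ zero    f = + 0
∑ (suc k) f = f 0 ℤ.+ ∑ k (f ∘ suc)

sumℤ≡∑ : ∀ k (f : ℕ → ℤ) → sumℤ {k} (f ∘ toℕ) ≡ ∑ k f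
sumℤ≡∑ zero    f = refl
sumℤ≡∑ (suc k) f = cong (ℤ._+_ (f 0)) (sumℤ≡∑ k (f ∘ suc))

∑-cong : ∀ k {f g : ℕ → ℤ} → (∀ i → f i ≡ g i) → ∑ k f ≡ ∑ k g
∑-cong zero    f≗g = refl
∑-cong (suc k) f≗g = cong₂ ℤ._+_ (f≗g 0) (∑-cong k (f≗g ∘ suc))

∑-+ : ∀ a b (f : ℕ → ℤ) → ∑ (a + b) f ≡ ∑ a f ℤ.+ ∑ b (λ i → f (a + i))
∑-+ zero    b f = sym (ℤₚ.+-identityˡ (∑ b f))
∑-+ (suc a) b f = begin
  f 0 ℤ.+ ∑ (a + b) (f ∘ suc)                               ≡⟨ cong (ℤ._+_ (f 0)) (∑-+ a b (f ∘ suc)) ⟩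
  f 0 ℤ.+ (∑ a (f ∘ suc) ℤ.+ ∑ b (λ i → f (suc (a + i))))  ≡⟨ ℤₚ.+-assoc (f 0) _ _ ⟨
  f 0 ℤ.+ ∑ a (f ∘ suc) ℤ.+ ∑ b (λ i → f (suc (a + i)))    ∎
  where open ≡-Reasoning

◃-distribʳ-* : ∀ s m n → s ◃ (m * n) ≡ (s ◃ m) ℤ.* + n
◃-distribʳ-* Sign.+ m n = trans (ℤₚ.◃-distrib-* Sign.+ Sign.+ m n) (cong (ℤ._*_ (Sign.+ ◃ m)) (ℤₚ.+◃n≡+n n))
◃-distribʳ-* Sign.- m n = trans (ℤₚ.◃-distrib-* Sign.- Sign.+ m n) (cong (ℤ._*_ (Sign.- ◃ m)) (ℤₚ.+◃n≡+n n))

∑-◃-affine : ∀ k (σ : ℕ → Sign) (a b : ℕ → ℕ) x →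
  ∑ k (λ i → σ i ◃ (a i + b i * x)) ≡
  ∑ k (λ i → σ i ◃ a i) ℤ.+ ∑ k (λ i → σ i ◃ b i) ℤ.* + x
∑-◃-affine zero    σ a b x = refl
∑-◃-affine (suc k) σ a b x = begin
  (σ 0 ◃ (a 0 + b 0 * x)) ℤ.+ ∑ k (λ i → σ (suc i) ◃ (a (suc i) + b (suc i) * x))
    ≡⟨ cong₂ ℤ._+_ head (∑-◃-affine k (σ ∘ suc) (a ∘ suc) (b ∘ suc) x) ⟩
  ((σ 0 ◃ a 0) ℤ.+ (σ 0 ◃ b 0) ℤ.* + x) ℤ.+ (A ℤ.+ B ℤ.* + x)
    ≡⟨ regroup (σ 0 ◃ a 0) (σ 0 ◃ b 0) A B (+ x) ⟩
  ((σ 0 ◃ a 0) ℤ.+ A) ℤ.+ ((σ 0 ◃ b 0) ℤ.+ B) ℤ.* + x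
    ∎
  where
  open ≡-Reasoning
  A B : ℤ
  A = ∑ k (λ i → σ (suc i) ◃ a (suc i))
  B = ∑ k (λ i → σ (suc i) ◃ b (suc i))
  head : σ 0 ◃ (a 0 + b 0 * x) ≡ (σ 0 ◃ a 0) ℤ.+ (σ 0 ◃ b 0) ℤ.* + x
  head = trans (ℤₚ.◃-distrib-+ (σ 0) (a 0) (b 0 * x)) (cong (ℤ._+_ (σ 0 ◃ a 0)) (◃-distribʳ-* (σ 0) (b 0) x))
  regroup : ∀ (p q A B x : ℤ) → (p ℤ.+ q ℤ.* x) ℤ.+ (A ℤ.+ B ℤ.* x) ≡ (p ℤ.+ A) ℤ.+ (q ℤ.+ B) ℤ.* x
  regroup = ℤ-Solver.solve-∀

∑-◃-affine₂ : ∀ k (σ : ℕ → Sign) (a b c : ℕ → ℕ) x y →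
  ∑ k (λ i → σ i ◃ (a i + b i * x + c i * y)) ≡
  ∑ k (λ i → σ i ◃ a i) ℤ.+ ∑ k (λ i → σ i ◃ b i) ℤ.* + x ℤ.+ ∑ k (λ i → σ i ◃ c i) ℤ.* + y
∑-◃-affine₂ k σ a b c x y =
  trans (∑-◃-affine k σ (λ i → a i + b i * x) c y)
        (cong (λ S → S ℤ.+ ∑ k (λ i → σ i ◃ c i) ℤ.* + y) (∑-◃-affine k σ a b x))

∑-◃-vanishes : ∀ k (σ : ℕ → Sign) (a b c : ℕ → ℕ) x y →
  ∑ k (λ i → σ i ◃ a i) ≡ + 0 → ∑ k (λ i → σ i ◃ b i) ≡ + 0 → ∑ k (λ i → σ i ◃ c i) ≡ + 0 →
  ∑ k (λ i → σ i ◃ (a i + b i * x + c i * y)) ≡ + 0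
∑-◃-vanishes k σ a b c x y A≡0 B≡0 C≡0 = trans (∑-◃-affine₂ k σ a b c x y) (vanish A≡0 B≡0 C≡0)
  where
  vanish : ∀ {A B C} → A ≡ + 0 → B ≡ + 0 → C ≡ + 0 → A ℤ.+ B ℤ.* + x ℤ.+ C ℤ.* + y ≡ + 0
  vanish refl refl refl = refl

∑-◃-multiple : ∀ k (σ : ℕ → Sign) (a b : ℕ → ℕ) x {γ M D} →
  ∑ k (λ i → σ i ◃ a i) ≡ γ ℤ.* + M → ∑ k (λ i → σ i ◃ b i) ≡ γ ℤ.* + D →
  ∑ k (λ i → σ i ◃ (a i + b i * x)) ≡ γ ℤ.* + (M + D * x)
∑-◃-multiple k σ a b x {γ} {M} {D} A≡γM B≡γD = begin
  ∑ k (λ i → σ i ◃ (a i + b i * x))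
    ≡⟨ ∑-◃-affine k σ a b x ⟩
  ∑ k (λ i → σ i ◃ a i) ℤ.+ ∑ k (λ i → σ i ◃ b i) ℤ.* + x
    ≡⟨ cong₂ (λ A B → A ℤ.+ B ℤ.* + x) A≡γM B≡γD ⟩
  γ ℤ.* + M ℤ.+ γ ℤ.* + D ℤ.* + x
    ≡⟨ factor γ (+ M) (+ D) (+ x) ⟩
  γ ℤ.* (+ M ℤ.+ + D ℤ.* + x)
    ≡⟨ cong (ℤ._*_ γ) (trans (ℤₚ.pos-+ M (D * x)) (cong (ℤ._+_ (+ M)) (ℤₚ.pos-* D x))) ⟨
  γ ℤ.* + (M + D * x)
    ∎
  where
  open ≡-Reasoning
  factor : ∀ (γ M D x : ℤ) → γ ℤ.* M ℤ.+ γ ℤ.* D ℤ.* x ≡ γ ℤ.* (M ℤ.+ D ℤ.* x)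
  factor = ℤ-Solver.solve-∀

multiple⇒∣ : ∀ {x} γ M → x ≡ γ ℤ.* + M → + M ∣ x
multiple⇒∣ γ M refl = divides ℤ.∣ γ ∣ (ℤₚ.abs-* γ (+ M))

prefixSum : (ℕ → ℕ) → ℕ → ℕ
prefixSum ℓ zero    = 0
prefixSum ℓ (suc R) = prefixSum ℓ R + ℓ R

prefixSum-affine : ∀ (a b : ℕ → ℕ) x R →
  prefixSum (λ R → a R + b R * x) R ≡ prefixSum a R + prefixSum b R * x
prefixSum-affine a b x zero    = refl
prefixSum-affine a b x (suc R) = begin
  prefixSum (λ R → a R + b R * x) R + (a R + b R * x)
    ≡⟨ cong (_+ (a R + b R * x)) (prefixSum-affine a b x R) ⟩
  prefixSum a R + prefixSum b R * x + (a R + b R * x)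
    ≡⟨ regroup (prefixSum a R) (prefixSum b R) (a R) (b R) x ⟩
  (prefixSum a R + a R) + (prefixSum b R + b R) * x
    ∎
  where
  open ≡-Reasoning
  regroup : ∀ p q a b x → p + q * x + (a + b * x) ≡ (p + a) + (q + b) * x
  regroup = solve-∀

prefixSum-mono-≤ : ∀ ℓ {R R′} → R ≤ R′ → prefixSum ℓ R ≤ prefixSum ℓ R′
prefixSum-mono-≤ ℓ {R′ = zero}  z≤n = ℕₚ.≤-refl
prefixSum-mono-≤ ℓ {R′ = suc R′} R≤1+R′ with ℕₚ.m≤n⇒m<n∨m≡n R≤1+R′
... | inj₁ (s≤s R≤R′) = ℕₚ.≤-trans (prefixSum-mono-≤ ℓ R≤R′) (ℕₚ.m≤m+n _ (ℓ R′))
... | inj₂ refl        = ℕₚ.≤-refl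

prefixSum-+-< : ∀ ℓ {R R′ m} → m < ℓ R → R < R′ → prefixSum ℓ R + m < prefixSum ℓ R′
prefixSum-+-< ℓ {R} m<ℓR R<R′ =
  ℕₚ.<-≤-trans (ℕₚ.+-monoʳ-< (prefixSum ℓ R) m<ℓR) (prefixSum-mono-≤ ℓ R<R′)

prefixSum-+-injective : ∀ ℓ {R R′ m m′} → m < ℓ R → m′ < ℓ R′ →
  prefixSum ℓ R + m ≡ prefixSum ℓ R′ + m′ → R ≡ R′ × m ≡ m′
prefixSum-+-injective ℓ {R} {R′} {m} {m′} m<ℓR m′<ℓR′ eq with ℕₚ.<-cmp R R′
... | tri≈ _ refl _ = refl , ℕₚ.+-cancelˡ-≡ (prefixSum ℓ R) m m′ eq
... | tri< R<R′ _ _ = ⊥-elim (ℕₚ.<-irrefl eq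
      (ℕₚ.<-≤-trans (prefixSum-+-< ℓ m<ℓR R<R′) (ℕₚ.m≤m+n _ m′)))
... | tri> _ _ R′<R = ⊥-elim (ℕₚ.<-irrefl (sym eq)
      (ℕₚ.<-≤-trans (prefixSum-+-< ℓ m′<ℓR′ R′<R) (ℕₚ.m≤m+n _ m)))

prefixSum-+-<-bound : ∀ ℓ N → (∀ {R} → N ≤ R → ℓ R ≡ 0) →
  ∀ {R m} → m < ℓ R → prefixSum ℓ R + m < prefixSum ℓ N
prefixSum-+-<-bound ℓ N ℓ-vanishes {R} m<ℓR with R <? N
... | yes R<N = prefixSum-+-< ℓ m<ℓR R<N
... | no  R≮N = ⊥-elim (ℕₚ.n≮0 (subst (_ <_) (ℓ-vanishes (ℕₚ.≮⇒≥ R≮N)) m<ℓR))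

*-+-injective : ∀ d {x x′ k k′} .{{_ : NonZero d}} → k < d → k′ < d →
  d * x + k ≡ d * x′ + k′ → x ≡ x′ × k ≡ k′
*-+-injective d {x} {x′} {k} {k′} k<d k′<d eq = x≡x′ , k≡k′
  where
  open ≡-Reasoning
  k≡k′ : k ≡ k′
  k≡k′ = begin
    k                  ≡⟨ m<n⇒m%n≡m k<d ⟨
    k % d              ≡⟨ %-remove-+ˡ k (m∣m*n x) ⟨
    (d * x + k) % d    ≡⟨ cong (_% d) eq ⟩
    (d * x′ + k′) % d  ≡⟨ %-remove-+ˡ k′ (m∣m*n x′) ⟩
    k′ % d             ≡⟨ m<n⇒m%n≡m k′<d ⟩
    k′                 ∎
  x≡x′ : x ≡ x′
  x≡x′ = ℕₚ.*-cancelˡ-≡ x x′ d (ℕₚ.+-cancelʳ-≡ k (d * x) (d * x′) (trans eq (cong (_+_ (d * x′)) (sym k≡k′))))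

*-+-<-* : ∀ d {x y k} → k < d → x < y → d * x + k < d * y
*-+-<-* d {x} {y} {k} k<d x<y = begin-strict
  d * x + k  <⟨ ℕₚ.+-monoʳ-< (d * x) k<d ⟩
  d * x + d  ≡⟨ ℕₚ.+-comm (d * x) d ⟩
  d + d * x  ≡⟨ ℕₚ.*-suc d x ⟨
  d * suc x  ≤⟨ ℕₚ.*-monoʳ-≤ d x<y ⟩
  d * y      ∎
  where open ℕₚ.≤-Reasoning

-- block q t c is column c of a block with q blocks to its left and t to its right, and
-- column t q j is the j-th column of what follows q blocks: t more blocks, then the core.
data Column : Set where
  block : (q t c : ℕ) → Column
  core  : (i : ℕ) → Column

column : (t q j : ℕ) → Column
column zero    q j = core j
column (suc t) q 0 = block q t 0
column (suc t) q 1 = block q t 1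
column (suc t) q 2 = block q t 2
column (suc t) q 3 = block q t 3
column (suc t) q (suc (suc (suc (suc j)))) = column t (suc q) j

ColumnValid : ℕ → ℕ → Column → Set
ColumnValid n₀ s (block q t c) = q + suc t ≡ s × c < 4
ColumnValid n₀ s (core i)      = i < n₀

columnIndex : ℕ → Column → ℕ
columnIndex s (block q t c) = q * 4 + c
columnIndex s (core i)      = s * 4 + i

column-valid : ∀ n₀ t q {j} → j < t * 4 + n₀ → ColumnValid n₀ (q + t) (column t q j)
column-valid n₀ zero    q {j} j<n₀ = j<n₀
column-valid n₀ (suc t) q {0} _ = refl , s≤s z≤n
column-valid n₀ (suc t) q {1} _ = refl , s≤s (s≤s z≤n)
column-valid n₀ (suc t) q {2} _ = refl , s≤s (s≤s (s≤s z≤n))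
column-valid n₀ (suc t) q {3} _ = refl , s≤s (s≤s (s≤s (s≤s z≤n)))
column-valid n₀ (suc t) q {suc (suc (suc (suc j)))} (s≤s (s≤s (s≤s (s≤s j<)))) =
  subst (λ s → ColumnValid n₀ s (column t (suc q) j)) (sym (ℕₚ.+-suc q t)) (column-valid n₀ t (suc q) j<)

columnIndex-column : ∀ t q j → columnIndex (q + t) (column t q j) ≡ q * 4 + j
columnIndex-column zero    q j = cong (λ s → s * 4 + j) (ℕₚ.+-identityʳ q)
columnIndex-column (suc t) q 0 = refl
columnIndex-column (suc t) q 1 = refl
columnIndex-column (suc t) q 2 = refl
columnIndex-column (suc t) q 3 = refl
columnIndex-column (suc t) q (suc (suc (suc (suc j)))) = begin
  columnIndex (q + suc t) (column t (suc q) j)  ≡⟨ cong (λ s → columnIndex s (column t (suc q) j)) (ℕₚ.+-suc q t) ⟩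
  columnIndex (suc q + t) (column t (suc q) j)  ≡⟨ columnIndex-column t (suc q) j ⟩
  suc q * 4 + j                                 ≡⟨ shift q j ⟩
  q * 4 + (4 + j)                               ∎
  where
  open ≡-Reasoning
  shift : ∀ q j → suc q * 4 + j ≡ q * 4 + (4 + j)
  shift = solve-∀

∑-column : ∀ n₀ t q (f : Column → ℤ) →
  (∀ {q′ t′} → q′ + suc t′ ≡ q + t → ∑ 4 (f ∘ block q′ t′) ≡ + 0) →
  ∑ (t * 4 + n₀) (f ∘ column t q) ≡ ∑ n₀ (f ∘ core)
∑-column n₀ zero    q f blocks-vanish = refl
∑-column n₀ (suc t) q f blocks-vanish = begin
  ∑ (4 + (t * 4 + n₀)) (f ∘ column (suc t) q)
    ≡⟨ ∑-+ 4 (t * 4 + n₀) (f ∘ column (suc t) q) ⟩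
  ∑ 4 (f ∘ block q t) ℤ.+ ∑ (t * 4 + n₀) (f ∘ column t (suc q))
    ≡⟨ cong₂ ℤ._+_ (blocks-vanish refl) (∑-column n₀ t (suc q) f (blocks-vanish ∘ shift)) ⟩
  + 0 ℤ.+ ∑ n₀ (f ∘ core)
    ≡⟨ ℤₚ.+-identityˡ _ ⟩
  ∑ n₀ (f ∘ core)
    ∎
  where
  open ≡-Reasoning
  shift : ∀ {s} → s ≡ suc q + t → s ≡ q + suc t
  shift eq = trans eq (sym (ℕₚ.+-suc q t))

-- Every block of four columns has 10, 4 and 6 of its 20 entries in the bands 1, 3 and 5;
-- band 3 is filled block by block from the left, bands 1 and 5 from the right.
leftStride : ℕ → ℕ
leftStride 3 = 4
leftStride _ = 0

rightStride : ℕ → ℕ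
rightStride 1 = 10
rightStride 5 = 6
rightStride _ = 0

bandWidth : ℕ → ℕ
bandWidth R = leftStride R + rightStride R

bandOffset : (R k q t : ℕ) → ℕ
bandOffset R k q t = leftStride R * q + (rightStride R * t + k)

bandOffset-injective : ∀ R {k k′ q q′ t t′} → k < bandWidth R → k′ < bandWidth R →
  q + suc t ≡ q′ + suc t′ → bandOffset R k q t ≡ bandOffset R k′ q′ t′ →
  k ≡ k′ × q ≡ q′ × t ≡ t′
bandOffset-injective 1 {q = q} {q′} {t} {t′} k< k′< s≡ eq =
  let t≡t′ , k≡k′ = *-+-injective 10 {t} {t′} k< k′< eq
  in k≡k′ , ℕₚ.+-cancelʳ-≡ (suc t) q q′ (trans s≡ (cong (λ t → q′ + suc t) (sym t≡t′))) , t≡t′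
bandOffset-injective 3 {q = q} {q′} {t} {t′} k< k′< s≡ eq =
  let q≡q′ , k≡k′ = *-+-injective 4 {q} {q′} k< k′< eq
  in k≡k′ , q≡q′ ,
     ℕₚ.suc-injective (ℕₚ.+-cancelˡ-≡ q (suc t) (suc t′) (trans s≡ (cong (λ q → q + suc t′) (sym q≡q′))))
bandOffset-injective 5 {q = q} {q′} {t} {t′} k< k′< s≡ eq =
  let t≡t′ , k≡k′ = *-+-injective 6 {t} {t′} k< k′< eq
  in k≡k′ , ℕₚ.+-cancelʳ-≡ (suc t) q q′ (trans s≡ (cong (λ t → q′ + suc t) (sym t≡t′))) , t≡t′
bandOffset-injective 0 () _ _ _
bandOffset-injective 2 () _ _ _
bandOffset-injective 4 () _ _ _
bandOffset-injective (suc (suc (suc (suc (suc (suc R)))))) () _ _ _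

bandOffset-< : ∀ R {k q t} → k < bandWidth R → bandOffset R k q t < bandWidth R * (q + suc t)
bandOffset-< 1 {q = q} {t} k< = *-+-<-* 10 k< (ℕₚ.m≤n+m (suc t) q)
bandOffset-< 3 {q = q} {t} k< = *-+-<-* 4 k< (ℕₚ.m<m+n q (s≤s z≤n))
bandOffset-< 5 {q = q} {t} k< = *-+-<-* 6 k< (ℕₚ.m≤n+m (suc t) q)
bandOffset-< 0 ()
bandOffset-< 2 ()
bandOffset-< 4 ()
bandOffset-< (suc (suc (suc (suc (suc (suc R)))))) ()

record Cell : Set where
  constructor cell
  field
    sign   : Sign
    region : ℕ
    slot   : ℕ

open Cell

+⟨_,_⟩ : ℕ → ℕ → Cell
+⟨ R , k ⟩ = cell Sign.+ R k

-⟨_,_⟩ : ℕ → ℕ → Cell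
-⟨ R , k ⟩ = cell Sign.- R k

SlotsWithin : (ℕ → ℕ) → ℕ → (ℕ → ℕ → Cell) → Set
SlotsWithin length m x = ∀ {r} → r < 5 → ∀ {i} → i < m → slot (x r i) < length (region (x r i))

slotsWithin? : ∀ length m x → Dec (SlotsWithin length m x)
slotsWithin? length m x = allUpTo? (λ r → allUpTo? (λ i → slot (x r i) <? length (region (x r i))) m) 5

CellsInjective : ℕ → (ℕ → ℕ → Cell) → Set
CellsInjective m x = ∀ {r} → r < 5 → ∀ {i} → i < m → ∀ {r′} → r′ < 5 → ∀ {i′} → i′ < m →
  region (x r i) ≡ region (x r′ i′) → slot (x r i) ≡ slot (x r′ i′) → r ≡ r′ × i ≡ i′

cellsInjective? : ∀ m x → Dec (CellsInjective m x)
cellsInjective? m x =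
  allUpTo? (λ r → allUpTo? (λ i → allUpTo? (λ r′ → allUpTo? (λ i′ →
    region (x r i) ℕₚ.≟ region (x r′ i′) →-dec
    slot (x r i) ℕₚ.≟ slot (x r′ i′) →-dec
    (r ℕₚ.≟ r′ ×-dec i ℕₚ.≟ i′)) m) 5) m) 5

nth : {A : Set} → A → List A → ℕ → A
nth d []       i       = d
nth d (x ∷ xs) zero    = x
nth d (x ∷ xs) (suc i) = nth d xs i

-- Regions 0, 2, 4, 6 are the core intervals, of sizes L₀, L₂, L₄, L₆. A core cell (σ, R, k)
-- stands for σ times the k-th value of region R; in a block between q and t others, a cell
-- (σ, R, k) stands for σ times the value at position bandOffset R k q t of band R.
-- The quotients of the core rows and columns are listed in order; missing ones are 0.
record Design : Set where
  field
    n₀                        : ℕ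
    L₀ L₂ L₄ L₆               : ℕ
    coreRows blockRows        : List (List Cell)
    rowQuotients colQuotients : List ℤ

module Construction (D : Design) where
  open Design D

  coreLength : ℕ → ℕ
  coreLength 0 = L₀
  coreLength 2 = L₂
  coreLength 4 = L₄
  coreLength 6 = L₆
  coreLength _ = 0

  core-band-disjoint : ∀ R {o k} → o < coreLength R → k < bandWidth R → ⊥
  core-band-disjoint 0 _ ()
  core-band-disjoint 1 () _
  core-band-disjoint 2 _ ()
  core-band-disjoint 3 () _
  core-band-disjoint 4 _ ()
  core-band-disjoint 5 () _
  core-band-disjoint 6 _ ()
  core-band-disjoint (suc (suc (suc (suc (suc (suc (suc R))))))) () _

  regionLength : ℕ → ℕ → ℕ
  regionLength s R = coreLength R + bandWidth R * s

  regionLength-vanishes : ∀ s {R} → 7 ≤ R → regionLength s R ≡ 0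
  regionLength-vanishes s (s≤s (s≤s (s≤s (s≤s (s≤s (s≤s (s≤s _))))))) = refl

  α β : ℕ → ℤ
  α = nth (+ 0) rowQuotients
  β = nth (+ 0) colQuotients

  coreCell blockCell : ℕ → ℕ → Cell
  coreCell  r = nth +⟨ 0 , 0 ⟩ (nth [] coreRows r)
  blockCell r = nth +⟨ 0 , 0 ⟩ (nth [] blockRows r)

  cellAt : ℕ → Column → Cell
  cellAt r (block q t c) = blockCell r c
  cellAt r (core i)      = coreCell r i

  offset : ℕ → Column → ℕ
  offset r (block q t c) = bandOffset (region (blockCell r c)) (slot (blockCell r c)) q t
  offset r (core i)      = slot (coreCell r i)

  value : ℕ → ℕ → Column → ℕ
  value s r d = suc (prefixSum (regionLength s) (region (cellAt r d)) + offset r d)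

  entry : ℕ → ℕ → Column → ℤ
  entry s r d = sign (cellAt r d) ◃ value s r d

  array : ∀ s → Array 5 (s * 4 + n₀)
  array s i j = entry s (toℕ i) (column s 0 (toℕ j))

  modulus : ℕ → ℕ
  modulus n = 2 * (5 * n) + 1

  coreConst coreSlope : Cell → ℕ
  coreConst x = suc (prefixSum coreLength (region x) + slot x)
  coreSlope x = prefixSum bandWidth (region x)

  blockConst blockLeft blockRight : Cell → ℕ
  blockConst x = suc (prefixSum coreLength (region x) + prefixSum bandWidth (region x) + slot x)
  blockLeft  x = prefixSum bandWidth (region x) + leftStride (region x)
  blockRight x = prefixSum bandWidth (region x) + rightStride (region x)

  SumsToMultiple : ℕ → (ℕ → Cell) → ℤ → Set
  SumsToMultiple k x γ =
    ∑ k (λ i → sign (x i) ◃ coreConst (x i)) ≡ γ ℤ.* + modulus n₀ ×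
    ∑ k (λ i → sign (x i) ◃ coreSlope (x i)) ≡ γ ℤ.* + 40

  sumsToMultiple? : ∀ k x γ → Dec (SumsToMultiple k x γ)
  sumsToMultiple? k x γ = _ ℤₚ.≟ _ ×-dec _ ℤₚ.≟ _

  Balanced : ℕ → (ℕ → Cell) → Set
  Balanced k x =
    ∑ k (λ i → sign (x i) ◃ blockConst (x i)) ≡ + 0 ×
    ∑ k (λ i → sign (x i) ◃ blockLeft (x i)) ≡ + 0 ×
    ∑ k (λ i → sign (x i) ◃ blockRight (x i)) ≡ + 0

  balanced? : ∀ k x → Dec (Balanced k x)
  balanced? k x = _ ℤₚ.≟ _ ×-dec _ ℤₚ.≟ _ ×-dec _ ℤₚ.≟ _

  record Checks : Set where
    constructor checks
    field
      coreLength-total : prefixSum coreLength 7 ≡ 5 * n₀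
      core-rows        : ∀ {r} → r < 5 → SumsToMultiple n₀ (coreCell r) (α r)
      core-columns     : ∀ {i} → i < n₀ → SumsToMultiple 5 (λ r → coreCell r i) (β i)
      block-rows       : ∀ {r} → r < 5 → Balanced 4 (blockCell r)
      block-columns    : ∀ {c} → c < 4 → Balanced 5 (λ r → blockCell r c)
      core-slots       : SlotsWithin coreLength n₀ coreCell
      block-slots      : SlotsWithin bandWidth 4 blockCell
      core-injective   : CellsInjective n₀ coreCell
      block-injective  : CellsInjective 4 blockCell

  -- The implicit fields are eta-expanded so that their type is not instantiated too early.
  checks? : Dec Checks
  checks? =
    map′ (λ (a , b , c , d , e , f , g , h , i) → checks a b c d e f g h i)
         (λ (checks a b c d e f g h i) →
            a , (λ {r} → b {r}) , (λ {i} → c {i}) , (λ {r} → d {r}) , (λ {c} → e {c}) ,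
            (λ {r} → f {r}) , (λ {r} → g {r}) , (λ {r} → h {r}) , (λ {r} → i {r}))
         (prefixSum coreLength 7 ℕₚ.≟ 5 * n₀
          ×-dec allUpTo? (λ r → sumsToMultiple? n₀ (coreCell r) (α r)) 5
          ×-dec allUpTo? (λ i → sumsToMultiple? 5 (λ r → coreCell r i) (β i)) n₀
          ×-dec allUpTo? (λ r → balanced? 4 (blockCell r)) 5
          ×-dec allUpTo? (λ c → balanced? 5 (λ r → blockCell r c)) 4
          ×-dec slotsWithin? coreLength n₀ coreCell
          ×-dec slotsWithin? bandWidth 4 blockCell
          ×-dec cellsInjective? n₀ coreCell
          ×-dec cellsInjective? 4 blockCell)

  module Correctness (ok : Checks) where
    open Checks ok

    core-value : ∀ s r i → value s r (core i) ≡ coreConst (coreCell r i) + coreSlope (coreCell r i) * s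
    core-value s r i = begin
      suc (prefixSum (regionLength s) R + k)
        ≡⟨ cong (λ p → suc (p + k)) (prefixSum-affine coreLength bandWidth s R) ⟩
      suc (prefixSum coreLength R + prefixSum bandWidth R * s + k)
        ≡⟨ regroup (prefixSum coreLength R) (prefixSum bandWidth R) s k ⟩
      suc (prefixSum coreLength R + k) + prefixSum bandWidth R * s
        ∎
      where
      open ≡-Reasoning
      R k : ℕ
      R = region (coreCell r i)
      k = slot (coreCell r i)
      regroup : ∀ p q s k → suc (p + q * s + k) ≡ suc (p + k) + q * s
      regroup = solve-∀

    block-value : ∀ r c q t → value (q + suc t) r (block q t c) ≡
      blockConst (blockCell r c) + blockLeft (blockCell r c) * q + blockRight (blockCell r c) * t
    block-value r c q t = begin
      suc (prefixSum (regionLength (q + suc t)) R + bandOffset R k q t)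
        ≡⟨ cong (λ p → suc (p + bandOffset R k q t)) (prefixSum-affine coreLength bandWidth (q + suc t) R) ⟩
      suc (prefixSum coreLength R + prefixSum bandWidth R * (q + suc t) + bandOffset R k q t)
        ≡⟨ regroup (prefixSum coreLength R) (prefixSum bandWidth R) (leftStride R) (rightStride R) k q t ⟩
      blockConst (blockCell r c) + blockLeft (blockCell r c) * q + blockRight (blockCell r c) * t
        ∎
      where
      open ≡-Reasoning
      R k : ℕ
      R = region (blockCell r c)
      k = slot (blockCell r c)
      regroup : ∀ p w a b k q t → suc (p + w * (q + suc t) + (a * q + (b * t + k))) ≡
                                  suc (p + w + k) + (w + a) * q + (w + b) * t
      regroup = solve-∀

    block-vanishes : ∀ m (r c : ℕ → ℕ) q t → Balanced m (λ i → blockCell (r i) (c i)) →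
      ∑ m (λ i → entry (q + suc t) (r i) (block q t (c i))) ≡ + 0
    block-vanishes m r c q t (A , B , C) =
      trans (∑-cong m (λ i → cong (sign (x i) ◃_) (block-value (r i) (c i) q t)))
            (∑-◃-vanishes m (sign ∘ x) (blockConst ∘ x) (blockLeft ∘ x) (blockRight ∘ x) q t A B C)
      where
      x : ℕ → Cell
      x i = blockCell (r i) (c i)

    modulus-blocks : ∀ s → modulus (s * 4 + n₀) ≡ modulus n₀ + 40 * s
    modulus-blocks s = expand s n₀
      where
      expand : ∀ s n₀ → 2 * (5 * (s * 4 + n₀)) + 1 ≡ 2 * (5 * n₀) + 1 + 40 * s
      expand = solve-∀

    core-multiple : ∀ m (r i : ℕ → ℕ) s γ → SumsToMultiple m (λ j → coreCell (r j) (i j)) γ →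
      ∑ m (λ j → entry s (r j) (core (i j))) ≡ γ ℤ.* + modulus (s * 4 + n₀)
    core-multiple m r i s γ (A , B) =
      trans (∑-cong m (λ j → cong (sign (x j) ◃_) (core-value s (r j) (i j))))
            (trans (∑-◃-multiple m (sign ∘ x) (coreConst ∘ x) (coreSlope ∘ x) s {γ} A B)
                   (cong (λ M → γ ℤ.* + M) (sym (modulus-blocks s))))
      where
      x : ℕ → Cell
      x j = coreCell (r j) (i j)

    row-sum : ∀ s {r} → r < 5 → ∑ (s * 4 + n₀) (entry s r ∘ column s 0) ≡ α r ℤ.* + modulus (s * 4 + n₀)
    row-sum s {r} r<5 =
      trans (∑-column n₀ s 0 (entry s r) blocks-vanish)
            (core-multiple n₀ (λ _ → r) (λ i → i) s (α r) (core-rows r<5))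
      where
      blocks-vanish : ∀ {q t} → q + suc t ≡ s → ∑ 4 (entry s r ∘ block q t) ≡ + 0
      blocks-vanish {q} {t} refl = block-vanishes 4 (λ _ → r) (λ c → c) q t (block-rows r<5)

    columnQuotient : Column → ℤ
    columnQuotient (block _ _ _) = + 0
    columnQuotient (core i)      = β i

    column-sum : ∀ s d → ColumnValid n₀ s d →
      ∑ 5 (λ r → entry s r d) ≡ columnQuotient d ℤ.* + modulus (s * 4 + n₀)
    column-sum _ (block q t c) (refl , c<4) = block-vanishes 5 (λ r → r) (λ _ → c) q t (block-columns c<4)
    column-sum s (core i)      i<n₀         = core-multiple 5 (λ r → r) (λ _ → i) s (β i) (core-columns i<n₀)

    offset-< : ∀ s r d → r < 5 → ColumnValid n₀ s d → offset r d < regionLength s (region (cellAt r d))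
    offset-< _ r (block q t c) r<5 (refl , c<4) =
      ℕₚ.<-≤-trans (bandOffset-< (region (blockCell r c)) (block-slots r<5 c<4)) (ℕₚ.m≤n+m _ _)
    offset-< s r (core i) r<5 i<n₀ = ℕₚ.<-≤-trans (core-slots r<5 i<n₀) (ℕₚ.m≤m+n _ _)

    regionLength-total : ∀ s → prefixSum (regionLength s) 7 ≡ 5 * (s * 4 + n₀)
    regionLength-total s = begin
      prefixSum (regionLength s) 7    ≡⟨ prefixSum-affine coreLength bandWidth s 7 ⟩
      prefixSum coreLength 7 + 20 * s ≡⟨ cong (λ L → L + 20 * s) coreLength-total ⟩
      5 * n₀ + 20 * s                 ≡⟨ collect n₀ s ⟩
      5 * (s * 4 + n₀)                ∎
      where
      open ≡-Reasoning
      collect : ∀ n₀ s → 5 * n₀ + 20 * s ≡ 5 * (s * 4 + n₀)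
      collect = solve-∀

    value-≤ : ∀ s r d → r < 5 → ColumnValid n₀ s d → value s r d ≤ 5 * (s * 4 + n₀)
    value-≤ s r d r<5 valid =
      subst (value s r d ≤_) (regionLength-total s)
        (prefixSum-+-<-bound (regionLength s) 7 (regionLength-vanishes s) {region (cellAt r d)}
          (offset-< s r d r<5 valid))

    position-injective : ∀ {s} r r′ d d′ → r < 5 → r′ < 5 → ColumnValid n₀ s d → ColumnValid n₀ s d′ →
      region (cellAt r d) ≡ region (cellAt r′ d′) → offset r d ≡ offset r′ d′ → r ≡ r′ × d ≡ d′
    position-injective r r′ (core i) (core i′) r<5 r′<5 i<n₀ i′<n₀ R≡R′ k≡k′
      with core-injective r<5 i<n₀ r′<5 i′<n₀ R≡R′ k≡k′
    ... | refl , refl = refl , refl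
    position-injective r r′ (core i) (block _ _ c′) r<5 r′<5 i<n₀ (_ , c′<4) R≡R′ _ =
      ⊥-elim (core-band-disjoint (region (coreCell r i)) (core-slots r<5 i<n₀)
        (subst (λ R → slot (blockCell r′ c′) < bandWidth R) (sym R≡R′) (block-slots r′<5 c′<4)))
    position-injective r r′ (block _ _ c) (core i′) r<5 r′<5 (_ , c<4) i′<n₀ R≡R′ _ =
      ⊥-elim (core-band-disjoint (region (coreCell r′ i′)) (core-slots r′<5 i′<n₀)
        (subst (λ R → slot (blockCell r c) < bandWidth R) R≡R′ (block-slots r<5 c<4)))
    position-injective r r′ (block q t c) (block q′ t′ c′) r<5 r′<5 (refl , c<4) (s≡ , c′<4) R≡R′ o≡o′
      with bandOffset-injective (region (blockCell r c)) (block-slots r<5 c<4)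
             (subst (λ R → slot (blockCell r′ c′) < bandWidth R) (sym R≡R′) (block-slots r′<5 c′<4))
             (sym s≡) (trans o≡o′ (cong (λ R → bandOffset R (slot (blockCell r′ c′)) q′ t′) (sym R≡R′)))
    ... | k≡k′ , refl , refl with block-injective r<5 c<4 r′<5 c′<4 R≡R′ k≡k′
    ...   | refl , refl = refl , refl

    value-injective : ∀ s r r′ d d′ → r < 5 → r′ < 5 → ColumnValid n₀ s d → ColumnValid n₀ s d′ →
      value s r d ≡ value s r′ d′ → r ≡ r′ × d ≡ d′
    value-injective s r r′ d d′ r<5 r′<5 valid valid′ eq =
      let R≡R′ , o≡o′ = prefixSum-+-injective (regionLength s) {region (cellAt r d)} {region (cellAt r′ d′)}
                          (offset-< s r d r<5 valid) (offset-< s r′ d′ r′<5 valid′)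
                          (ℕₚ.suc-injective eq)
      in position-injective r r′ d d′ r<5 r′<5 valid valid′ R≡R′ o≡o′

    array-abs : ∀ s → AbsCondition (array s)
    array-abs s = bounds , injective
      where
      valid : (j : Fin (s * 4 + n₀)) → ColumnValid n₀ s (column s 0 (toℕ j))
      valid j = column-valid n₀ s 0 (toℕ<n j)
      ∣array∣ : ∀ i j → ℤ.∣ array s i j ∣ ≡ value s (toℕ i) (column s 0 (toℕ j))
      ∣array∣ i j = ℤₚ.abs-◃ (sign (cellAt (toℕ i) (column s 0 (toℕ j)))) _
      bounds : ∀ i j → 1 ≤ ℤ.∣ array s i j ∣ × ℤ.∣ array s i j ∣ ≤ 5 * (s * 4 + n₀)
      bounds i j rewrite ∣array∣ i j = s≤s z≤n , value-≤ s _ _ (toℕ<n i) (valid j)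
      injective : ∀ i j i′ j′ → ℤ.∣ array s i j ∣ ≡ ℤ.∣ array s i′ j′ ∣ → i ≡ i′ × j ≡ j′
      injective i j i′ j′ eq rewrite ∣array∣ i j | ∣array∣ i′ j′ =
        let r≡r′ , d≡d′ = value-injective s _ _ _ _ (toℕ<n i) (toℕ<n i′) (valid j) (valid j′) eq
        in toℕ-injective r≡r′ ,
           toℕ-injective (trans (sym (columnIndex-column s 0 (toℕ j)))
                         (trans (cong (columnIndex s) d≡d′) (columnIndex-column s 0 (toℕ j′))))

    rowSum-array : ∀ s i → rowSum (array s) i ≡ α (toℕ i) ℤ.* + modulus (s * 4 + n₀)
    rowSum-array s i = trans (sumℤ≡∑ (s * 4 + n₀) (entry s (toℕ i) ∘ column s 0)) (row-sum s (toℕ<n i))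

    colSum-array : ∀ s j → colSum (array s) j ≡ columnQuotient (column s 0 (toℕ j)) ℤ.* + modulus (s * 4 + n₀)
    colSum-array s j = trans (sumℤ≡∑ 5 (λ r → entry s r (column s 0 (toℕ j))))
                             (column-sum s _ (column-valid n₀ s 0 (toℕ<n j)))

    heffter : ∀ s → Σ (Array 5 (s * 4 + n₀)) (IsHeffter 5 (s * 4 + n₀))
    heffter s = array s , array-abs s ,
      (λ i → multiple⇒∣ (α (toℕ i)) _ (rowSum-array s i)) ,
      (λ j → multiple⇒∣ (columnQuotient (column s 0 (toℕ j))) _ (colSum-array s j))

    integerHeffter : (∀ r → α r ≡ + 0) → (∀ i → β i ≡ + 0) →
      ∀ s → Σ (Array 5 (s * 4 + n₀)) (IsIntegerHeffter 5 (s * 4 + n₀))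
    integerHeffter α≡0 β≡0 s = array s , array-abs s , rows , columns
      where
      rows : ∀ i → rowSum (array s) i ≡ + 0
      rows i = trans (rowSum-array s i) (cong (λ γ → γ ℤ.* + modulus (s * 4 + n₀)) (α≡0 (toℕ i)))
      quotient≡0 : ∀ d → columnQuotient d ≡ + 0
      quotient≡0 (block _ _ _) = refl
      quotient≡0 (core i)      = β≡0 i
      columns : ∀ j → colSum (array s) j ≡ + 0
      columns j = trans (colSum-array s j)
                        (cong (λ γ → γ ℤ.* + modulus (s * 4 + n₀)) (quotient≡0 (column s 0 (toℕ j))))

standardBlock : List (List Cell)
standardBlock =
  (-⟨ 1 , 0 ⟩ ∷ -⟨ 1 , 5 ⟩ ∷ +⟨ 1 , 4 ⟩ ∷ +⟨ 1 , 1 ⟩ ∷ []) ∷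
  (-⟨ 1 , 8 ⟩ ∷ +⟨ 1 , 7 ⟩ ∷ -⟨ 3 , 0 ⟩ ∷ +⟨ 3 , 1 ⟩ ∷ []) ∷
  (+⟨ 1 , 9 ⟩ ∷ -⟨ 5 , 5 ⟩ ∷ -⟨ 1 , 6 ⟩ ∷ +⟨ 5 , 2 ⟩ ∷ []) ∷
  (-⟨ 3 , 3 ⟩ ∷ +⟨ 3 , 2 ⟩ ∷ +⟨ 5 , 4 ⟩ ∷ -⟨ 5 , 3 ⟩ ∷ []) ∷
  (+⟨ 5 , 1 ⟩ ∷ +⟨ 1 , 2 ⟩ ∷ -⟨ 1 , 3 ⟩ ∷ -⟨ 5 , 0 ⟩ ∷ []) ∷
  []

design₃ : Design
design₃ = record
  { n₀ = 3 ; L₀ = 2 ; L₂ = 6 ; L₄ = 0 ; L₆ = 7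
  ; coreRows =
      (-⟨ 0 , 0 ⟩ ∷ -⟨ 6 , 5 ⟩ ∷ +⟨ 6 , 6 ⟩ ∷ []) ∷
      (-⟨ 2 , 0 ⟩ ∷ +⟨ 6 , 2 ⟩ ∷ -⟨ 2 , 5 ⟩ ∷ []) ∷
      (+⟨ 2 , 4 ⟩ ∷ +⟨ 2 , 3 ⟩ ∷ -⟨ 6 , 4 ⟩ ∷ []) ∷
      (+⟨ 6 , 0 ⟩ ∷ -⟨ 2 , 2 ⟩ ∷ -⟨ 2 , 1 ⟩ ∷ []) ∷
      (-⟨ 6 , 3 ⟩ ∷ +⟨ 0 , 1 ⟩ ∷ +⟨ 6 , 1 ⟩ ∷ []) ∷
      []
  ; blockRows = standardBlock
  ; rowQuotients = []
  ; colQuotients = []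
  }

design₄ : Design
design₄ = record
  { n₀ = 4 ; L₀ = 2 ; L₂ = 6 ; L₄ = 0 ; L₆ = 12
  ; coreRows =
      (+⟨ 0 , 0 ⟩ ∷ -⟨ 2 , 0 ⟩ ∷ +⟨ 6 , 0 ⟩ ∷ -⟨ 2 , 4 ⟩ ∷ []) ∷
      (+⟨ 6 , 2 ⟩ ∷ +⟨ 6 , 9 ⟩ ∷ -⟨ 6 , 1 ⟩ ∷ -⟨ 6 , 10 ⟩ ∷ []) ∷
      (-⟨ 6 , 4 ⟩ ∷ +⟨ 2 , 1 ⟩ ∷ -⟨ 2 , 2 ⟩ ∷ +⟨ 6 , 5 ⟩ ∷ []) ∷
      (-⟨ 6 , 6 ⟩ ∷ -⟨ 6 , 8 ⟩ ∷ +⟨ 6 , 3 ⟩ ∷ +⟨ 6 , 11 ⟩ ∷ []) ∷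
      (+⟨ 6 , 7 ⟩ ∷ -⟨ 0 , 1 ⟩ ∷ -⟨ 2 , 3 ⟩ ∷ -⟨ 2 , 5 ⟩ ∷ []) ∷
      []
  ; blockRows = standardBlock
  ; rowQuotients = []
  ; colQuotients = []
  }

design₅ : Design
design₅ = record
  { n₀ = 5 ; L₀ = 4 ; L₂ = 10 ; L₄ = 6 ; L₆ = 5
  ; coreRows =
      (+⟨ 0 , 0 ⟩ ∷ +⟨ 2 , 8 ⟩ ∷ +⟨ 2 , 5 ⟩ ∷ +⟨ 0 , 3 ⟩ ∷ +⟨ 6 , 2 ⟩ ∷ []) ∷
      (-⟨ 2 , 1 ⟩ ∷ +⟨ 0 , 1 ⟩ ∷ -⟨ 4 , 1 ⟩ ∷ +⟨ 2 , 0 ⟩ ∷ +⟨ 4 , 0 ⟩ ∷ []) ∷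
      (+⟨ 2 , 3 ⟩ ∷ +⟨ 6 , 3 ⟩ ∷ -⟨ 2 , 9 ⟩ ∷ -⟨ 2 , 6 ⟩ ∷ -⟨ 2 , 2 ⟩ ∷ []) ∷
      (+⟨ 6 , 1 ⟩ ∷ -⟨ 2 , 4 ⟩ ∷ +⟨ 4 , 2 ⟩ ∷ -⟨ 4 , 3 ⟩ ∷ -⟨ 2 , 7 ⟩ ∷ []) ∷
      (-⟨ 6 , 4 ⟩ ∷ +⟨ 6 , 0 ⟩ ∷ +⟨ 0 , 2 ⟩ ∷ +⟨ 4 , 5 ⟩ ∷ -⟨ 4 , 4 ⟩ ∷ []) ∷
      []
  ; blockRows =
      (-⟨ 1 , 0 ⟩ ∷ -⟨ 1 , 4 ⟩ ∷ +⟨ 1 , 1 ⟩ ∷ +⟨ 1 , 3 ⟩ ∷ []) ∷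
      (-⟨ 1 , 9 ⟩ ∷ +⟨ 1 , 6 ⟩ ∷ -⟨ 3 , 0 ⟩ ∷ +⟨ 3 , 3 ⟩ ∷ []) ∷
      (+⟨ 1 , 5 ⟩ ∷ -⟨ 5 , 5 ⟩ ∷ -⟨ 1 , 2 ⟩ ∷ +⟨ 5 , 2 ⟩ ∷ []) ∷
      (-⟨ 3 , 2 ⟩ ∷ +⟨ 3 , 1 ⟩ ∷ +⟨ 5 , 4 ⟩ ∷ -⟨ 5 , 3 ⟩ ∷ []) ∷
      (+⟨ 5 , 1 ⟩ ∷ +⟨ 1 , 7 ⟩ ∷ -⟨ 1 , 8 ⟩ ∷ -⟨ 5 , 0 ⟩ ∷ []) ∷
      []
  ; rowQuotients = + 1 ∷ []
  ; colQuotients = + 0 ∷ + 1 ∷ []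
  }

design₆ : Design
design₆ = record
  { n₀ = 6 ; L₀ = 7 ; L₂ = 14 ; L₄ = 4 ; L₆ = 5
  ; coreRows =
      (+⟨ 0 , 0 ⟩ ∷ -⟨ 2 , 3 ⟩ ∷ +⟨ 6 , 0 ⟩ ∷ -⟨ 2 , 6 ⟩ ∷ +⟨ 6 , 4 ⟩ ∷ +⟨ 6 , 3 ⟩ ∷ []) ∷
      (+⟨ 0 , 2 ⟩ ∷ +⟨ 2 , 4 ⟩ ∷ +⟨ 0 , 3 ⟩ ∷ -⟨ 0 , 4 ⟩ ∷ +⟨ 6 , 2 ⟩ ∷ +⟨ 2 , 11 ⟩ ∷ []) ∷
      (+⟨ 0 , 5 ⟩ ∷ -⟨ 0 , 1 ⟩ ∷ +⟨ 6 , 1 ⟩ ∷ +⟨ 2 , 5 ⟩ ∷ +⟨ 0 , 6 ⟩ ∷ +⟨ 2 , 2 ⟩ ∷ []) ∷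
      (+⟨ 2 , 0 ⟩ ∷ -⟨ 4 , 1 ⟩ ∷ +⟨ 2 , 12 ⟩ ∷ -⟨ 2 , 1 ⟩ ∷ -⟨ 2 , 13 ⟩ ∷ +⟨ 4 , 3 ⟩ ∷ []) ∷
      (-⟨ 2 , 10 ⟩ ∷ +⟨ 4 , 2 ⟩ ∷ -⟨ 2 , 8 ⟩ ∷ +⟨ 2 , 7 ⟩ ∷ +⟨ 2 , 9 ⟩ ∷ -⟨ 4 , 0 ⟩ ∷ []) ∷
      []
  ; blockRows =
      (-⟨ 1 , 0 ⟩ ∷ -⟨ 1 , 7 ⟩ ∷ +⟨ 1 , 5 ⟩ ∷ +⟨ 1 , 2 ⟩ ∷ []) ∷
      (-⟨ 1 , 6 ⟩ ∷ +⟨ 1 , 3 ⟩ ∷ -⟨ 3 , 0 ⟩ ∷ +⟨ 3 , 3 ⟩ ∷ []) ∷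
      (+⟨ 1 , 8 ⟩ ∷ -⟨ 5 , 1 ⟩ ∷ -⟨ 1 , 9 ⟩ ∷ +⟨ 5 , 2 ⟩ ∷ []) ∷
      (-⟨ 3 , 2 ⟩ ∷ +⟨ 3 , 1 ⟩ ∷ +⟨ 5 , 5 ⟩ ∷ -⟨ 5 , 4 ⟩ ∷ []) ∷
      (+⟨ 5 , 0 ⟩ ∷ +⟨ 1 , 4 ⟩ ∷ -⟨ 1 , 1 ⟩ ∷ -⟨ 5 , 3 ⟩ ∷ []) ∷
      []
  ; rowQuotients = + 1 ∷ + 1 ∷ + 1 ∷ []
  ; colQuotients = + 0 ∷ + 0 ∷ + 1 ∷ + 0 ∷ + 1 ∷ + 1 ∷ []
  }

module H₃ = Construction.Correctness design₃ (from-yes (Construction.checks? design₃))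
module H₄ = Construction.Correctness design₄ (from-yes (Construction.checks? design₄))
module H₅ = Construction.Correctness design₅ (from-yes (Construction.checks? design₅))
module H₆ = Construction.Correctness design₆ (from-yes (Construction.checks? design₆))

blocks+core : ∀ n → n ≥ 3 →
  Σ ℕ λ s → n ≡ s * 4 + 3 ⊎ n ≡ s * 4 + 4 ⊎ n ≡ s * 4 + 5 ⊎ n ≡ s * 4 + 6
blocks+core 0 ()
blocks+core 1 (s≤s ())
blocks+core 2 (s≤s (s≤s ()))
blocks+core 3 _ = 0 , inj₁ refl
blocks+core 4 _ = 0 , inj₂ (inj₁ refl)
blocks+core 5 _ = 0 , inj₂ (inj₂ (inj₁ refl))
blocks+core 6 _ = 0 , inj₂ (inj₂ (inj₂ refl))
blocks+core (suc (suc (suc (suc (suc (suc (suc m))))))) _ with blocks+core (3 + m) (s≤s (s≤s (s≤s z≤n)))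
... | s , n≡ = suc s , Sum.map shift (Sum.map shift (Sum.map shift shift)) n≡
  where
  shift : ∀ {a b} → a ≡ b → 4 + a ≡ 4 + b
  shift = cong (_+_ 4)

residue-not-0-or-3 : ∀ s r → ¬ (r % 4 ≡ 0 ⊎ r % 4 ≡ 3) → ¬ ((s * 4 + r) % 4 ≡ 0 ⊎ (s * 4 + r) % 4 ≡ 3)
residue-not-0-or-3 s r r∉ = r∉ ∘ subst (λ k → k ≡ 0 ⊎ k ≡ 3) [4s+r]%4≡r%4
  where
  [4s+r]%4≡r%4 : (s * 4 + r) % 4 ≡ r % 4
  [4s+r]%4≡r%4 = trans (cong (_% 4) (ℕₚ.+-comm (s * 4) r)) ([m+kn]%n≡m%n r s 4)

theorem7 : (n : ℕ) → n ≥ 3 →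
    Σ (Array 5 n) (IsHeffter 5 n) ×
    ((n % 4 ≡ 0 ⊎ n % 4 ≡ 3) → Σ (Array 5 n) (IsIntegerHeffter 5 n))
theorem7 n n≥3 with blocks+core n n≥3
... | s , inj₁ refl               = H₃.heffter s , λ _ → H₃.integerHeffter (λ _ → refl) (λ _ → refl) s
... | s , inj₂ (inj₁ refl)        = H₄.heffter s , λ _ → H₄.integerHeffter (λ _ → refl) (λ _ → refl) s
... | s , inj₂ (inj₂ (inj₁ refl)) = H₅.heffter s , ⊥-elim ∘ residue-not-0-or-3 s 5 λ { (inj₁ ()) ; (inj₂ ()) }
... | s , inj₂ (inj₂ (inj₂ refl)) = H₆.heffter s , ⊥-elim ∘ residue-not-0-or-3 s 6 λ { (inj₁ ()) ; (inj₂ ()) }
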